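{- Let $n\geq 1$ and let $\phi\in F_n$. Then $\phi$ is join-irreducible (i.e. its class in $H_n$ is join-irreducible) if and only if the set $C(\phi)$ has a minimum element with respect to $\subseteq$.
   Context: $F_n$ is the set of propositional formulas in variables $x_1,\ldots,x_n$ (connectives $\wedge,\vee,\rightarrow$, constants $\bot,\top$); $H_n$ is $F_n$ modulo intuitionistic provable equivalence (the free Heyting algebra on $n$ generators). An element $a\in H_n$ is join-irreducible if $a\neq\bot$ and $a=b\vee c$ implies $a=b$ or $a=c$. Kripke semantics: a Kripke model is a poset of nodes with each node $\alpha$ assigned a set $w(\alpha)$ of variables, monotone upward; $\alpha\Vdash x$ iff $x\in w(\alpha)$, $\wedge,\vee$ are pointwise, $\bot$ is never forced, and $\alpha\Vdash\rho\rightarrow\chi$ iff every $\beta\geq\alpha$ forcing $\rho$ forces $\chi$. Bellissima's model $K_n$: its nodes are partitioned into finite levels $L^1_n,L^2_n,\ldots$. $L^1_n$ consists of one node $e_U$ with $w(e_U)=U$ for each $U\subseteq\{x_1,\ldots,x_n\}$. For $m\geq 1$, $L^{m+1}_n$ consists of one new node $\mathrm{node}(A,U)$ with $w(\mathrm{node}(A,U))=U$ for each pair $(A,U)$ where either (a) $A$ is an antichain of at least two nodes of levels $\leq m$, containing a node of level $m$, and $U\subseteq\bigcap_{\alpha\in A}w(\alpha)$, or (b) $A=\{\alpha\}$ with $\alpha\in L^m_n$ and $U\subsetneq w(\alpha)$. The order on $K_n$ is the reflexive-transitive closure of the relation $\mathrm{node}(A,U)<\alpha$ for $\alpha\in A$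 (so the elements of $A$ are the immediate successors of $\mathrm{node}(A,U)$). For a formula $\phi$, $\mathrm{Subform}(\phi)$ is the set of its subformulas (including $\phi$), and for a node $\alpha$, $\mathrm{Type}_\phi(\alpha)=\{\psi\in\mathrm{Subform}(\phi):\alpha\Vdash\psi\}$. Then $C(\phi)=\{T\subseteq\mathrm{Subform}(\phi): \phi\in T \text{ and } T=\mathrm{Type}_\phi(\alpha) \text{ for some node } \alpha\in K_n\}$. -}

module Defs where

open import Data.Nat using (ℕ; suc; _≤_)
open import Data.Fin using (Fin)
open import Data.Fin.Subset using (Subset; _⊆_; _⊂_) renaming (_∈_ to _∈ₛ_)
open import Data.List using (List; []; _∷_; length)
open import Data.List.Membership.Propositional using (_∈_)
open import Data.List.Relation.Unary.All using (All)
open import Data.List.Relation.Unary.Any using (Any)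
open import Data.List.Relation.Unary.AllPairs using (AllPairs)
open import Data.Product using (Σ; _×_; ∃)
open import Data.Sum using (_⊎_)
open import Data.Empty using () renaming (⊥ to Empty)
open import Data.Unit using () renaming (⊤ to Unit)
open import Relation.Nullary using (¬_)

data Formula (n : ℕ) : Set where
  var        : Fin n → Formula n
  ⊥' ⊤'      : Formula n
  _∧'_ _∨'_ _⇒_ : Formula n → Formula n → Formula n

infixr 6 _∧'_
infixr 5 _∨'_
infixr 4 _⇒_

data _∈Sub_ {n : ℕ} (ψ : Formula n) : Formula n → Set where
  here : ψ ∈Sub ψ
  ∧l : ∀ {a b} → ψ ∈Sub a → ψ ∈Sub (a ∧' b)
  ∧r : ∀ {a b} → ψ ∈Sub b → ψ ∈Sub (a ∧' b)
  ∨l : ∀ {a b} → ψ ∈Sub a → ψ ∈Sub (a ∨' b)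
  ∨r : ∀ {a b} → ψ ∈Sub b → ψ ∈Sub (a ∨' b)
  ⇒l : ∀ {a b} → ψ ∈Sub a → ψ ∈Sub (a ⇒ b)
  ⇒r : ∀ {a b} → ψ ∈Sub b → ψ ∈Sub (a ⇒ b)

data _⊢_ {n : ℕ} (Γ : List (Formula n)) : Formula n → Set where
  hyp  : ∀ {A} → A ∈ Γ → Γ ⊢ A
  ⊤I   : Γ ⊢ ⊤'
  ⊥E   : ∀ {A} → Γ ⊢ ⊥' → Γ ⊢ A
  ∧I   : ∀ {A B} → Γ ⊢ A → Γ ⊢ B → Γ ⊢ (A ∧' B)
  ∧E₁  : ∀ {A B} → Γ ⊢ (A ∧' B) → Γ ⊢ A
  ∧E₂  : ∀ {A B} → Γ ⊢ (A ∧' B) → Γ ⊢ B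
  ∨I₁  : ∀ {A B} → Γ ⊢ A → Γ ⊢ (A ∨' B)
  ∨I₂  : ∀ {A B} → Γ ⊢ B → Γ ⊢ (A ∨' B)
  ∨E   : ∀ {A B C} → Γ ⊢ (A ∨' B) → (A ∷ Γ) ⊢ C → (B ∷ Γ) ⊢ C → Γ ⊢ C
  ⇒I   : ∀ {A B} → (A ∷ Γ) ⊢ B → Γ ⊢ (A ⇒ B)
  ⇒E   : ∀ {A B} → Γ ⊢ (A ⇒ B) → Γ ⊢ A → Γ ⊢ B

-- intuitionistic provable equivalence (equality in H_n)
_≡H_ : {n : ℕ} → Formula n → Formula n → Set
φ ≡H ψ = ((φ ∷ []) ⊢ ψ) × ((ψ ∷ []) ⊢ φ)

JoinIrreducible : {n : ℕ} → Formula n → Set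
JoinIrreducible {n} φ =
  (¬ (φ ≡H ⊥')) ×
  ((ψ χ : Formula n) → φ ≡H (ψ ∨' χ) → (φ ≡H ψ) ⊎ (φ ≡H χ))

-- Bellissima's model K_n.
-- Node terms: e U (level 1) and node A U (A = list of immediate successors).

data Node (n : ℕ) : Set where
  e    : Subset n → Node n
  node : List (Node n) → Subset n → Node n

w : {n : ℕ} → Node n → Subset n
w (e U)      = U
w (node A U) = U

-- identity of nodes: node(A,U) is determined by the SET A and U
data _≈_ {n : ℕ} : Node n → Node n → Set where
  e≈    : ∀ {U} → e U ≈ e U
  node≈ : ∀ {A B U} → All (λ a → Any (λ b → a ≈ b) B) A
                    → All (λ b → Any (λ a → a ≈ b) A) B
                    → node A U ≈ node B U

data _≤K_ {n : ℕ} : Node n → Node n → Set where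
  ≤-refl : ∀ {α β} → α ≈ β → α ≤K β
  ≤-step : ∀ {A U β} → Any (λ a → a ≤K β) A → node A U ≤K β

Incomparable : {n : ℕ} → Node n → Node n → Set
Incomparable α β = (¬ (α ≤K β)) × (¬ (β ≤K α))

-- well-formed node terms = nodes of K_n (the level of node(A,U) is
-- 1 + the maximal level in A, so the level conditions are automatic)
data IsNode {n : ℕ} : Node n → Set where
  isE      : ∀ {U} → IsNode (e U)
  isAnti   : ∀ {A U} → All IsNode A → 2 ≤ length A
           → AllPairs Incomparable A
           → All (λ α → U ⊆ w α) A
           → IsNode (node A U)
  isSingle : ∀ {α U} → IsNode α → U ⊂ w α → IsNode (node (α ∷ []) U)

_⊩_ : {n : ℕ} → Node n → Formula n → Set
α ⊩ var i    = i ∈ₛ w α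
α ⊩ ⊥'       = Empty
α ⊩ ⊤'       = Unit
α ⊩ (ρ ∧' χ) = (α ⊩ ρ) × (α ⊩ χ)
α ⊩ (ρ ∨' χ) = (α ⊩ ρ) ⊎ (α ⊩ χ)
α ⊩ (ρ ⇒ χ)  = ∀ β → IsNode β → α ≤K β → β ⊩ ρ → β ⊩ χ

TypeSubset : {n : ℕ} → Formula n → Node n → Node n → Set
TypeSubset φ α β = ∀ ψ → ψ ∈Sub φ → α ⊩ ψ → β ⊩ ψ

-- C(φ) = { Type_φ(α) : α ∈ K_n, α ⊩ φ };  C(φ) has a ⊆-minimum element
CHasMinimum : {n : ℕ} → Formula n → Set
CHasMinimum φ =
  Σ _ λ α → IsNode α × (α ⊩ φ) ×
    (∀ β → IsNode β → β ⊩ φ → TypeSubset φ α β)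

module Submission where

-- Two properties of K_n carry the proof. Completeness: every sequent Γ ⇒ Δ of
-- subformulas is either derivable or refuted at a node of K_n, found by a
-- terminating backward proof search whose saturated leaves are turned into
-- nodes. Gluing: finitely many nodes L and a valuation U contained in all of
-- theirs have a node of K_n with valuation U whose proper successors are
-- exactly the nodes above L, namely Bellissima's node(A, U) for the minimal
-- elements A of L.
--
-- If φ is join-irreducible it does not prove the disjunction of its
-- subformulas that it does not prove, so some node forces φ and only
-- consequences of φ among its subformulas; that node has the minimum type.
-- Conversely, let α have the minimum type and φ ≡ ψ ∨ χ with φ ⊬ ψ, φ ⊬ χ,
-- refuted at β and γ. Gluing α, β, γ gives a node with the φ-type of α, hence
-- forcing φ and so ψ or χ, which persists to β or γ.

open import Defs
open import Data.Bool.Properties using (T-≡) renaming (_≟_ to _≟ᵇ_)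
open import Data.Empty using (⊥-elim) renaming (⊥ to Empty)
open import Data.Fin.Properties using () renaming (_≟_ to _≟ᶠⁱⁿ_)
open import Data.Fin.Subset using (Subset; _⊆_; _⊂_; ⋂) renaming (_∈_ to _∈ₛ_)
open import Data.Fin.Subset.Properties
  using (_⊂?_; _∈?_; ∈⊤; ⊆-trans; ⊆-reflexive; ⊆-antisym; x∈p∩q⁺; x∈p∩q⁻)
open import Data.List using (List; []; _∷_; _++_; filter; foldr; map)
open import Data.List.Membership.Propositional using (_∈_; _∉_; lose; find)
open import Data.List.Membership.Propositional.Properties
  using (∈-filter⁺; ∈-filter⁻; ∈-++⁺ˡ; ∈-++⁺ʳ; ∈-++⁻)
open import Data.List.Relation.Binary.Subset.Propositional using () renaming (_⊆_ to _⊆ᴸ_)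
open import Data.List.Relation.Binary.Subset.Propositional.Properties using (Any-resp-⊆; ∷⁺ʳ; ∈-∷⁺ʳ)
open import Data.List.Relation.Unary.All as All using (All; []; _∷_)
open import Data.List.Relation.Unary.All.Properties as All using (all-filter; anti-mono; ¬All⇒Any¬)
open import Data.List.Relation.Unary.AllPairs using (AllPairs; []; _∷_)
import Data.List.Relation.Unary.AllPairs.Properties as AllPairs
open import Data.List.Relation.Unary.Any as Any using (Any; here; there; any?)
open import Data.Nat using (ℕ; suc; _≤_; _<_; s≤s; z≤n)
open import Data.Nat.Induction using (<-wellFounded)
open import Data.Nat.Properties using (m≤n⇒m≤1+n; m<n⇒m<1+n)
open import Data.Product as Product using (∃; ∃-syntax; _×_; _,_; proj₁; proj₂; uncurry)
open import Data.Product.Function.NonDependent.Propositional using (_×-⇔_)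
open import Data.Product.Relation.Binary.Lex.Strict using (×-Lex; ×-wellFounded)
open import Data.Sum as Sum using (_⊎_; inj₁; inj₂; [_,_]′)
open import Data.Sum.Function.Propositional using (_⊎-⇔_)
open import Data.Unit using (tt) renaming (⊤ to Unit)
open import Data.Vec using (tabulate)
open import Data.Vec.Properties using (≡-dec; lookup∘tabulate; lookup⇒[]=; []=⇒lookup)
open import Function using (_∘_; _on_; id)
open import Function.Bundles using (_⇔_; mk⇔; Equivalence)
import Function.Properties.Equivalence as ⇔
open import Induction.WellFounded as WF using (WellFounded; WfRec)
open import Level using (Level; 0ℓ; _⊔_)
open import Relation.Binary using (Rel; Reflexive; Transitive; Decidable; DecidableEquality)
import Relation.Binary.Construct.On as On
open import Relation.Binary.PropositionalEquality using (_≡_; refl; sym; trans; subst)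
open import Relation.Nullary using (¬_; Dec; yes; no)
open import Relation.Nullary.Decidable
  using (map′; _×-dec_; _⊎-dec_; _→-dec_; ¬?; decidable-stable; isYes; toWitness; fromWitness)

open Equivalence using (to; from)

private
  variable
    ℓ ℓ′ : Level
    Y : Set ℓ′
    P Q R : Y → Set ℓ
    xs : List Y
    n : ℕ
    α β γ δ : Node n
    A L : List (Node n)
    U : Subset n

Any-map-with : (∀ {x} → P x → Q x → R x) → All P xs → Any Q xs → Any R xs
Any-map-with f (p ∷ _)  (here q)  = here (f p q)
Any-map-with f (_ ∷ ps) (there i) = there (Any-map-with f ps i)

lookup-any : {Z : Set} → All P xs → Any Q xs → (∀ {x} → P x → Q x → Z) → Z
lookup-any (p ∷ _)  (here q)  f = f p q
lookup-any (_ ∷ ps) (there i) f = lookup-any ps i f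

self-cover : {R : Rel Y ℓ} → All (λ x → R x x) xs → All (λ x → Any (R x) xs) xs
self-cover Rxx = All.tabulate λ x∈xs → Any.map (λ { refl → All.lookup Rxx x∈xs }) x∈xs

all-dec : All (Dec ∘ P) xs → Dec (All P xs)
all-dec []       = yes []
all-dec (d ∷ ds) = map′ (uncurry _∷_) All.uncons (d ×-dec all-dec ds)

any-dec : All (Dec ∘ P) xs → Dec (Any P xs)
any-dec []       = no λ ()
any-dec (d ∷ ds) = map′ Any.fromSum Any.toSum (d ⊎-dec any-dec ds)

⋂-lower-bound : (ps : List (Subset n)) → All (⋂ ps ⊆_) ps
⋂-lower-bound []       = []
⋂-lower-bound (p ∷ ps) =
  (λ i∈ → proj₁ (x∈p∩q⁻ p _ i∈)) ∷ All.map (λ ⋂⊆q {_} i∈ → ⋂⊆q (proj₂ (x∈p∩q⁻ p _ i∈))) (⋂-lower-bound ps)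

∈-⋂ : ∀ {i} {ps : List (Subset n)} → All (i ∈ₛ_) ps → i ∈ₛ ⋂ ps
∈-⋂ []         = ∈⊤
∈-⋂ (i∈p ∷ ps) = x∈p∩q⁺ (i∈p , ∈-⋂ ps)

⊆∧⊄⇒≡ : {p q : Subset n} → p ⊆ q → ¬ p ⊂ q → p ≡ q
⊆∧⊄⇒≡ {p = p} p⊆q p⊄q =
  ⊆-antisym p⊆q λ {x} x∈q → decidable-stable (x ∈? p) λ x∉p → p⊄q (p⊆q , x , x∈q , x∉p)

-- Minimal elements under a decidable preorder

module Minimal {X : Set ℓ′} {_≤_ : Rel X ℓ}
  (≤-refl : Reflexive _≤_) (≤-trans : Transitive _≤_) (_≤?_ : Decidable _≤_) where

  _∥_ : Rel X ℓ
  x ∥ y = ¬ x ≤ y × ¬ y ≤ x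

  record Minimals (L : List X) : Set (ℓ′ ⊔ ℓ) where
    field
      elements  : List X
      ⊆L        : elements ⊆ᴸ L
      antichain : AllPairs _∥_ elements
      cover     : All (λ y → Any (_≤ y) elements) L

  minimals : (L : List X) → Minimals L
  minimals [] = record { elements = [] ; ⊆L = λ () ; antichain = [] ; cover = [] }
  minimals (x ∷ L) with minimals L
  ... | M with any? (_≤? x) (Minimals.elements M)
  ...   | yes m≤x = record
          { elements = elements ; ⊆L = there ∘ ⊆L ; antichain = antichain ; cover = m≤x ∷ cover }
    where open Minimals M
  ...   | no ∄m≤x = record
          { elements  = x ∷ not-above-x
          ; ⊆L        = λ { (here refl) → here refl ; (there i) → there (⊆L (proj₁ (∈-filter⁻ _ i))) }
          ; antichain = All.tabulate incomparable ∷ AllPairs.filter⁺ _ antichain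
          ; cover     = here ≤-refl ∷ All.map cover′ cover }
    where
    open Minimals M
    not-above-x = filter (λ m → ¬? (x ≤? m)) elements
    incomparable : ∀ {m} → m ∈ not-above-x → x ∥ m
    incomparable i with ∈-filter⁻ _ i
    ... | m∈ , x≰m = x≰m , λ m≤x → ∄m≤x (lose m∈ m≤x)
    cover′ : ∀ {y} → Any (_≤ y) elements → Any (_≤ y) (x ∷ not-above-x)
    cover′ i with find i
    ... | m , m∈ , m≤y with x ≤? m
    ...   | yes x≤m = here (≤-trans x≤m m≤y)
    ...   | no x≰m  = there (lose (∈-filter⁺ _ m∈ x≰m) m≤y)

-- The order of K_n

module _ (P : Node n → Set) (P-e : ∀ {U} → P (e U)) (P-node : ∀ {A U} → All P A → P (node A U)) where

  node-induction : ∀ α → P α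
  node-induction-all : ∀ A → All P A

  node-induction (e U)      = P-e
  node-induction (node A U) = P-node (node-induction-all A)

  node-induction-all []      = []
  node-induction-all (α ∷ A) = node-induction α ∷ node-induction-all A

≈-refl : (α : Node n) → α ≈ α
≈-refl = node-induction (λ α → α ≈ α) e≈ (λ A≈A → node≈ (self-cover A≈A) (self-cover A≈A))

≈-sym : α ≈ β → β ≈ α
≈-sym {α = α} = node-induction Motive (λ { e≈ → e≈ }) node-case α
  where
  Motive : Node _ → Set
  Motive α = ∀ {β} → α ≈ β → β ≈ α
  node-case : All Motive A → Motive (node A U)
  node-case ih (node≈ A⊑B B⊑A) =
    node≈ (All.map (Any-map-with (λ sym a≈b → sym a≈b) ih) B⊑A)
          (All.zipWith (λ (sym , a≈B) → Any.map (λ a≈b → sym a≈b) a≈B) (ih , A⊑B))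

≈-trans : α ≈ β → β ≈ γ → α ≈ γ
≈-trans {α = α} = node-induction Motive (λ { e≈ e≈ → e≈ }) node-case α
  where
  Motive : Node _ → Set
  Motive α = ∀ {β γ} → α ≈ β → β ≈ γ → α ≈ γ
  node-case : All Motive A → Motive (node A U)
  node-case ih (node≈ A⊑B B⊑A) (node≈ B⊑C C⊑B) =
    node≈ (All.zipWith (λ (trans , a≈B) → lookup-any B⊑C a≈B λ b≈C a≈b →
                           Any.map (λ b≈c → trans a≈b b≈c) b≈C) (ih , A⊑B))
          (All.map (λ B≈c → lookup-any B⊑A B≈c λ A≈b b≈c →
                              Any-map-with (λ trans a≈b → trans a≈b b≈c) ih A≈b) C⊑B)

w-resp-≈ : α ≈ β → w α ≡ w β
w-resp-≈ e≈          = refl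
w-resp-≈ (node≈ _ _) = refl

≤K-refl : (α : Node n) → α ≤K α
≤K-refl α = ≤-refl (≈-refl α)

≈-≤K-trans : α ≈ β → β ≤K γ → α ≤K γ
≈-≤K-trans {α = α} = node-induction Motive (λ { e≈ (≤-refl r) → ≤-refl r }) node-case α
  where
  Motive : Node _ → Set
  Motive α = ∀ {β γ} → α ≈ β → β ≤K γ → α ≤K γ
  node-case : All Motive A → Motive (node A U)
  node-case _  α≈β (≤-refl β≈γ) = ≤-refl (≈-trans α≈β β≈γ)
  node-case ih (node≈ _ B⊑A) (≤-step B≤γ) =
    ≤-step (lookup-any B⊑A B≤γ λ A≈b b≤γ → Any-map-with (λ trans a≈b → trans a≈b b≤γ) ih A≈b)

≤K-trans : α ≤K β → β ≤K γ → α ≤K γ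
≤K-trans {α = α} = node-induction Motive (λ { (≤-refl r) → ≈-≤K-trans r }) node-case α
  where
  Motive : Node _ → Set
  Motive α = ∀ {β γ} → α ≤K β → β ≤K γ → α ≤K γ
  node-case : All Motive A → Motive (node A U)
  node-case _  (≤-refl r)   = ≈-≤K-trans r
  node-case ih (≤-step A≤β) β≤γ = ≤-step (Any-map-with (λ trans a≤β → trans a≤β β≤γ) ih A≤β)

_≟ₛ_ : DecidableEquality (Subset n)
_≟ₛ_ = ≡-dec _≟ᵇ_

_≈?_ : (α β : Node n) → Dec (α ≈ β)
_≈?_ {n} α = node-induction Motive e-case node-case α
  where
  Motive : Node n → Set
  Motive α = ∀ β → Dec (α ≈ β)
  e-case : Motive (e U)
  e-case {U} (e V)      = map′ (λ { refl → e≈ }) (λ { e≈ → refl }) (U ≟ₛ V)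
  e-case     (node _ _) = no λ ()
  node-case : All Motive A → Motive (node A U)
  node-case      _  (e _) = no λ ()
  node-case {U = U} ih (node B V) =
    map′ (λ { (refl , A⊑B , B⊑A) → node≈ A⊑B B⊑A }) (λ { (node≈ A⊑B B⊑A) → refl , A⊑B , B⊑A })
      (U ≟ₛ V ×-dec all-dec (All.map (λ a≈? → any? a≈? B) ih)
              ×-dec All.all? (λ b → any-dec (All.map (λ a≈? → a≈? b) ih)) B)

_≤K?_ : (α β : Node n) → Dec (α ≤K β)
_≤K?_ {n} α = node-induction Motive e-case node-case α
  where
  Motive : Node n → Set
  Motive α = ∀ β → Dec (α ≤K β)
  e-case : Motive (e U)
  e-case {U} β = map′ ≤-refl (λ { (≤-refl r) → r }) (e U ≈? β)
  node-case : All Motive A → Motive (node A U)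
  node-case {A} {U} ih β =
    map′ [ ≤-refl , ≤-step ]′ (λ { (≤-refl r) → inj₁ r ; (≤-step i) → inj₂ i })
      (node A U ≈? β ⊎-dec any-dec (All.map (λ a≤? → a≤? β) ih))

children-valid : IsNode (node A U) → All (λ a → IsNode a × U ⊆ w a) A
children-valid (isAnti valid _ _ U⊆A)   = All.zip (valid , U⊆A)
children-valid (isSingle valid (U⊆a , _)) = (valid , U⊆a) ∷ []

w-mono : IsNode α → α ≤K β → w α ⊆ w β
w-mono {α = α} = node-induction Motive (λ { _ (≤-refl r) → ⊆-reflexive (w-resp-≈ r) }) node-case α
  where
  Motive : Node _ → Set
  Motive α = ∀ {β} → IsNode α → α ≤K β → w α ⊆ w β
  node-case : All Motive A → Motive (node A U)
  node-case _  _     (≤-refl r)   = ⊆-reflexive (w-resp-≈ r)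
  node-case ih valid (≤-step A≤β) =
    lookup-any (All.zip (ih , children-valid valid)) A≤β
      λ (mono , valid-a , U⊆a) a≤β → ⊆-trans U⊆a (mono valid-a a≤β)

⊩-mono : IsNode α → α ≤K β → (C : Formula n) → α ⊩ C → β ⊩ C
⊩-mono valid α≤β (var i)  = w-mono valid α≤β
⊩-mono valid α≤β ⊤'       = id
⊩-mono valid α≤β (C ∧' D) (c , d)  = ⊩-mono valid α≤β C c , ⊩-mono valid α≤β D d
⊩-mono valid α≤β (C ∨' D) (inj₁ c) = inj₁ (⊩-mono valid α≤β C c)
⊩-mono valid α≤β (C ∨' D) (inj₂ d) = inj₂ (⊩-mono valid α≤β D d)
⊩-mono valid α≤β (C ⇒ D)  f γ valid-γ β≤γ = f γ valid-γ (≤K-trans α≤β β≤γ)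

⊩-resp-≈ : α ≈ β → (C : Formula n) → α ⊩ C → β ⊩ C
⊩-resp-≈ α≈β (var i)  = subst (i ∈ₛ_) (w-resp-≈ α≈β)
⊩-resp-≈ α≈β ⊤'       = id
⊩-resp-≈ α≈β (C ∧' D) (c , d)  = ⊩-resp-≈ α≈β C c , ⊩-resp-≈ α≈β D d
⊩-resp-≈ α≈β (C ∨' D) (inj₁ c) = inj₁ (⊩-resp-≈ α≈β C c)
⊩-resp-≈ α≈β (C ∨' D) (inj₂ d) = inj₂ (⊩-resp-≈ α≈β D d)
⊩-resp-≈ α≈β (C ⇒ D)  f γ valid-γ β≤γ = f γ valid-γ (≈-≤K-trans α≈β β≤γ)

soundness : {Γ : List (Formula n)} {C : Formula n} → Γ ⊢ C → IsNode α → All (α ⊩_) Γ → α ⊩ C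
soundness (hyp C∈Γ)     valid Γ-forced = All.lookup Γ-forced C∈Γ
soundness ⊤I            valid Γ-forced = tt
soundness (⊥E d)        valid Γ-forced with () ← soundness d valid Γ-forced
soundness (∧I d d′)     valid Γ-forced = soundness d valid Γ-forced , soundness d′ valid Γ-forced
soundness (∧E₁ d)       valid Γ-forced = proj₁ (soundness d valid Γ-forced)
soundness (∧E₂ d)       valid Γ-forced = proj₂ (soundness d valid Γ-forced)
soundness (∨I₁ d)       valid Γ-forced = inj₁ (soundness d valid Γ-forced)
soundness (∨I₂ d)       valid Γ-forced = inj₂ (soundness d valid Γ-forced)
soundness (∨E d d₁ d₂)  valid Γ-forced with soundness d valid Γ-forced
... | inj₁ a = soundness d₁ valid (a ∷ Γ-forced)
... | inj₂ b = soundness d₂ valid (b ∷ Γ-forced)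
soundness (⇒I d) valid Γ-forced γ valid-γ α≤γ a =
  soundness d valid-γ (a ∷ All.map (λ {C} → ⊩-mono valid α≤γ C) Γ-forced)
soundness {α = α} (⇒E d d′) valid Γ-forced =
  soundness d valid Γ-forced α valid (≤K-refl α) (soundness d′ valid Γ-forced)

-- Gluing

-- Forcing at a node with valuation U whose proper successors are the nodes above L.
⟨_,_⟩⊩_ : List (Node n) → Subset n → Formula n → Set
⟨ L , U ⟩⊩ var i    = i ∈ₛ U
⟨ L , U ⟩⊩ ⊥'       = Empty
⟨ L , U ⟩⊩ ⊤'       = Unit
⟨ L , U ⟩⊩ (C ∧' D) = ⟨ L , U ⟩⊩ C × ⟨ L , U ⟩⊩ D
⟨ L , U ⟩⊩ (C ∨' D) = ⟨ L , U ⟩⊩ C ⊎ ⟨ L , U ⟩⊩ D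
⟨ L , U ⟩⊩ (C ⇒ D)  = All (_⊩ (C ⇒ D)) L × (⟨ L , U ⟩⊩ C → ⟨ L , U ⟩⊩ D)

record Glues (L : List (Node n)) (U : Subset n) (δ : Node n) : Set where
  field
    valid      : IsNode δ
    valuation  : w δ ≡ U
    below      : All (δ ≤K_) L
    successors : ∀ {γ} → δ ≤K γ → δ ≈ γ ⊎ Any (_≤K γ) L

glued-⊩⇔ : Glues L U δ → (C : Formula n) → δ ⊩ C ⇔ ⟨ L , U ⟩⊩ C
glued-⊩⇔ g (var i)  = mk⇔ (subst (i ∈ₛ_) (Glues.valuation g)) (subst (i ∈ₛ_) (sym (Glues.valuation g)))
glued-⊩⇔ g ⊥'       = ⇔.refl
glued-⊩⇔ g ⊤'       = ⇔.refl
glued-⊩⇔ g (C ∧' D) = glued-⊩⇔ g C ×-⇔ glued-⊩⇔ g D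
glued-⊩⇔ g (C ∨' D) = glued-⊩⇔ g C ⊎-⇔ glued-⊩⇔ g D
glued-⊩⇔ {δ = δ} g (C ⇒ D) = mk⇔
  (λ f → All.map (λ δ≤β → ⊩-mono valid δ≤β (C ⇒ D) f) below ,
         λ c → to D⇔ (f δ valid (≤K-refl δ) (from C⇔ c)))
  (λ (L-forced , imp) γ valid-γ δ≤γ c →
     [ (λ δ≈γ → ⊩-resp-≈ δ≈γ D (from D⇔ (imp (to C⇔ (⊩-resp-≈ (≈-sym δ≈γ) C c)))))
     , (λ L≤γ → lookup-any L-forced L≤γ λ f β≤γ → f γ valid-γ β≤γ c)
     ]′ (successors δ≤γ))
  where
  open Glues g
  C⇔ = glued-⊩⇔ g C
  D⇔ = glued-⊩⇔ g D

open module MinimalNodes {n : ℕ} = Minimal {X = Node n} (λ {α} → ≤K-refl α) ≤K-trans _≤K?_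

glue-antichain : (M : Minimals L) → IsNode (node (Minimals.elements M) U)
               → Glues L U (node (Minimals.elements M) U)
glue-antichain M valid = record
  { valid      = valid
  ; valuation  = refl
  ; below      = All.map ≤-step (Minimals.cover M)
  ; successors = λ { (≤-refl r) → inj₁ r ; (≤-step M≤γ) → inj₂ (Any-resp-⊆ (Minimals.⊆L M) M≤γ) } }

-- node([m], U) belongs to K_n only when U ⊊ w m; when U = w m, m itself is the glued node.
glue-minimals : All IsNode L → All (λ β → U ⊆ w β) L → Minimals L → ∃ (Glues L U)
glue-minimals {U = U} _ _ record { elements = [] ; cover = cover } =
  e U , record
    { valid      = isE
    ; valuation  = refl
    ; below      = All.map (λ ()) cover
    ; successors = λ { (≤-refl r) → inj₁ r } }
glue-minimals {U = U} valid U⊆L M@record { elements = m ∷ [] ; ⊆L = ⊆L ; cover = cover } with U ⊂? w m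
... | yes U⊂m = _ , glue-antichain M (isSingle (All.lookup valid (⊆L (here refl))) U⊂m)
... | no  U⊄m = m , record
    { valid      = All.lookup valid (⊆L (here refl))
    ; valuation  = sym (⊆∧⊄⇒≡ (All.lookup U⊆L (⊆L (here refl))) U⊄m)
    ; below      = All.map (λ { (here m≤β) → m≤β }) cover
    ; successors = λ m≤γ → inj₂ (lose (⊆L (here refl)) m≤γ) }
glue-minimals valid U⊆L M@record { elements = _ ∷ _ ∷ _ ; ⊆L = ⊆L ; antichain = antichain } =
  _ , glue-antichain M (isAnti (anti-mono ⊆L valid) (s≤s (s≤s z≤n)) antichain (anti-mono ⊆L U⊆L))

glue : All IsNode L → All (λ β → U ⊆ w β) L → ∃ (Glues L U)
glue {L = L} valid U⊆L = glue-minimals valid U⊆L (minimals L)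

_≟ᶠ_ : DecidableEquality (Formula n)
var i    ≟ᶠ var j    = map′ (λ { refl → refl }) (λ { refl → refl }) (i ≟ᶠⁱⁿ j)
⊥'       ≟ᶠ ⊥'       = yes refl
⊤'       ≟ᶠ ⊤'       = yes refl
(a ∧' b) ≟ᶠ (c ∧' d) = map′ (λ { (refl , refl) → refl }) (λ { refl → refl , refl }) (a ≟ᶠ c ×-dec b ≟ᶠ d)
(a ∨' b) ≟ᶠ (c ∨' d) = map′ (λ { (refl , refl) → refl }) (λ { refl → refl , refl }) (a ≟ᶠ c ×-dec b ≟ᶠ d)
(a ⇒ b)  ≟ᶠ (c ⇒ d)  = map′ (λ { (refl , refl) → refl }) (λ { refl → refl , refl }) (a ≟ᶠ c ×-dec b ≟ᶠ d)
var _    ≟ᶠ ⊥'       = no λ ()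
var _    ≟ᶠ ⊤'       = no λ ()
var _    ≟ᶠ (_ ∧' _) = no λ ()
var _    ≟ᶠ (_ ∨' _) = no λ ()
var _    ≟ᶠ (_ ⇒ _)  = no λ ()
⊥'       ≟ᶠ var _    = no λ ()
⊥'       ≟ᶠ ⊤'       = no λ ()
⊥'       ≟ᶠ (_ ∧' _) = no λ ()
⊥'       ≟ᶠ (_ ∨' _) = no λ ()
⊥'       ≟ᶠ (_ ⇒ _)  = no λ ()
⊤'       ≟ᶠ var _    = no λ ()
⊤'       ≟ᶠ ⊥'       = no λ ()
⊤'       ≟ᶠ (_ ∧' _) = no λ ()
⊤'       ≟ᶠ (_ ∨' _) = no λ ()
⊤'       ≟ᶠ (_ ⇒ _)  = no λ ()
(_ ∧' _) ≟ᶠ var _    = no λ ()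
(_ ∧' _) ≟ᶠ ⊥'       = no λ ()
(_ ∧' _) ≟ᶠ ⊤'       = no λ ()
(_ ∧' _) ≟ᶠ (_ ∨' _) = no λ ()
(_ ∧' _) ≟ᶠ (_ ⇒ _)  = no λ ()
(_ ∨' _) ≟ᶠ var _    = no λ ()
(_ ∨' _) ≟ᶠ ⊥'       = no λ ()
(_ ∨' _) ≟ᶠ ⊤'       = no λ ()
(_ ∨' _) ≟ᶠ (_ ∧' _) = no λ ()
(_ ∨' _) ≟ᶠ (_ ⇒ _)  = no λ ()
(_ ⇒ _)  ≟ᶠ var _    = no λ ()
(_ ⇒ _)  ≟ᶠ ⊥'       = no λ ()
(_ ⇒ _)  ≟ᶠ ⊤'       = no λ ()
(_ ⇒ _)  ≟ᶠ (_ ∧' _) = no λ ()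
(_ ⇒ _)  ≟ᶠ (_ ∨' _) = no λ ()

_∈ᶠ?_ : (C : Formula n) (Γ : List (Formula n)) → Dec (C ∈ Γ)
C ∈ᶠ? Γ = any? (C ≟ᶠ_) Γ

subformulas : Formula n → List (Formula n)
subformulas (a ∧' b) = (a ∧' b) ∷ subformulas a ++ subformulas b
subformulas (a ∨' b) = (a ∨' b) ∷ subformulas a ++ subformulas b
subformulas (a ⇒ b)  = (a ⇒ b)  ∷ subformulas a ++ subformulas b
subformulas φ        = φ ∷ []

∈Sub-trans : {ψ χ φ : Formula n} → ψ ∈Sub χ → χ ∈Sub φ → ψ ∈Sub φ
∈Sub-trans ψ≤χ here    = ψ≤χ
∈Sub-trans ψ≤χ (∧l χ≤) = ∧l (∈Sub-trans ψ≤χ χ≤)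
∈Sub-trans ψ≤χ (∧r χ≤) = ∧r (∈Sub-trans ψ≤χ χ≤)
∈Sub-trans ψ≤χ (∨l χ≤) = ∨l (∈Sub-trans ψ≤χ χ≤)
∈Sub-trans ψ≤χ (∨r χ≤) = ∨r (∈Sub-trans ψ≤χ χ≤)
∈Sub-trans ψ≤χ (⇒l χ≤) = ⇒l (∈Sub-trans ψ≤χ χ≤)
∈Sub-trans ψ≤χ (⇒r χ≤) = ⇒r (∈Sub-trans ψ≤χ χ≤)

∈Sub⇒∈subformulas : {ψ : Formula n} (φ : Formula n) → ψ ∈Sub φ → ψ ∈ subformulas φ
∈Sub⇒∈subformulas (var _)  here = here refl
∈Sub⇒∈subformulas ⊥'       here = here refl
∈Sub⇒∈subformulas ⊤'       here = here refl
∈Sub⇒∈subformulas (_ ∧' _) here = here refl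
∈Sub⇒∈subformulas (_ ∨' _) here = here refl
∈Sub⇒∈subformulas (_ ⇒ _)  here = here refl
∈Sub⇒∈subformulas (a ∧' b) (∧l s) = there (∈-++⁺ˡ (∈Sub⇒∈subformulas a s))
∈Sub⇒∈subformulas (a ∧' b) (∧r s) = there (∈-++⁺ʳ (subformulas a) (∈Sub⇒∈subformulas b s))
∈Sub⇒∈subformulas (a ∨' b) (∨l s) = there (∈-++⁺ˡ (∈Sub⇒∈subformulas a s))
∈Sub⇒∈subformulas (a ∨' b) (∨r s) = there (∈-++⁺ʳ (subformulas a) (∈Sub⇒∈subformulas b s))
∈Sub⇒∈subformulas (a ⇒ b)  (⇒l s) = there (∈-++⁺ˡ (∈Sub⇒∈subformulas a s))
∈Sub⇒∈subformulas (a ⇒ b)  (⇒r s) = there (∈-++⁺ʳ (subformulas a) (∈Sub⇒∈subformulas b s))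

∈subformulas⇒∈Sub : {ψ : Formula n} (φ : Formula n) → ψ ∈ subformulas φ → ψ ∈Sub φ
∈subformulas⇒∈Sub (var _)  (here refl) = here
∈subformulas⇒∈Sub ⊥'       (here refl) = here
∈subformulas⇒∈Sub ⊤'       (here refl) = here
∈subformulas⇒∈Sub (a ∧' b) (here refl) = here
∈subformulas⇒∈Sub (a ∨' b) (here refl) = here
∈subformulas⇒∈Sub (a ⇒ b)  (here refl) = here
∈subformulas⇒∈Sub (a ∧' b) (there i) = [ ∧l ∘ ∈subformulas⇒∈Sub a , ∧r ∘ ∈subformulas⇒∈Sub b ]′ (∈-++⁻ _ i)
∈subformulas⇒∈Sub (a ∨' b) (there i) = [ ∨l ∘ ∈subformulas⇒∈Sub a , ∨r ∘ ∈subformulas⇒∈Sub b ]′ (∈-++⁻ _ i)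
∈subformulas⇒∈Sub (a ⇒ b)  (there i) = [ ⇒l ∘ ∈subformulas⇒∈Sub a , ⇒r ∘ ∈subformulas⇒∈Sub b ]′ (∈-++⁻ _ i)

SubformulaClosed : List (Formula n) → Set
SubformulaClosed S = ∀ {C ψ} → C ∈ S → ψ ∈Sub C → ψ ∈ S

subformulas-closed : (φ : Formula n) → SubformulaClosed (subformulas φ)
subformulas-closed φ C∈ ψ≤C = ∈Sub⇒∈subformulas φ (∈Sub-trans ψ≤C (∈subformulas⇒∈Sub φ C∈))

module _ {n : ℕ} where

  private
    variable
      a b C D : Formula n
      Γ Γ′ Δ : List (Formula n)

  weaken : Γ ⊆ᴸ Γ′ → Γ ⊢ C → Γ′ ⊢ C
  weaken ρ (hyp i)       = hyp (ρ i)
  weaken ρ ⊤I            = ⊤I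
  weaken ρ (⊥E d)        = ⊥E (weaken ρ d)
  weaken ρ (∧I d d′)     = ∧I (weaken ρ d) (weaken ρ d′)
  weaken ρ (∧E₁ d)       = ∧E₁ (weaken ρ d)
  weaken ρ (∧E₂ d)       = ∧E₂ (weaken ρ d)
  weaken ρ (∨I₁ d)       = ∨I₁ (weaken ρ d)
  weaken ρ (∨I₂ d)       = ∨I₂ (weaken ρ d)
  weaken ρ (∨E d d₁ d₂)  = ∨E (weaken ρ d) (weaken (∷⁺ʳ _ ρ) d₁) (weaken (∷⁺ʳ _ ρ) d₂)
  weaken ρ (⇒I d)        = ⇒I (weaken (∷⁺ʳ _ ρ) d)
  weaken ρ (⇒E d d′)     = ⇒E (weaken ρ d) (weaken ρ d′)

  hyp₀ : (C ∷ Γ) ⊢ C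
  hyp₀ = hyp (here refl)

  hyp₁ : (D ∷ C ∷ Γ) ⊢ C
  hyp₁ = hyp (there (here refl))

  cut : Γ ⊢ C → (C ∷ Γ) ⊢ D → Γ ⊢ D
  cut c d = ⇒E (⇒I d) c

  ⋁ : List (Formula n) → Formula n
  ⋁ = foldr _∨'_ ⊥'

  ⋁-intro : C ∈ Δ → Γ ⊢ C → Γ ⊢ ⋁ Δ
  ⋁-intro (here refl) d = ∨I₁ d
  ⋁-intro (there i)   d = ∨I₂ (⋁-intro i d)

  ∨-absorb : Γ ⊢ (C ∨' D) → (C ∷ Γ) ⊢ D → Γ ⊢ D
  ∨-absorb d d′ = ∨E d d′ hyp₀

  ⋁-forced : C ∈ Δ → α ⊩ C → α ⊩ ⋁ Δ
  ⋁-forced (here refl) c = inj₁ c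
  ⋁-forced (there i)   c = inj₂ (⋁-forced i c)

  ∧-left : (a ∧' b) ∈ Γ → (a ∷ b ∷ Γ) ⊢ D → Γ ⊢ D
  ∧-left i d = cut (∧E₂ (hyp i)) (cut (∧E₁ (hyp (there i))) d)

  ∨-left : (a ∨' b) ∈ Γ → (a ∷ Γ) ⊢ D → (b ∷ Γ) ⊢ D → Γ ⊢ D
  ∨-left i = ∨E (hyp i)

  ⇒-left : (a ⇒ b) ∈ Γ → Γ ⊢ (a ∨' D) → (b ∷ Γ) ⊢ D → Γ ⊢ D
  ⇒-left i d d′ = ∨-absorb d (cut (⇒E (hyp (there i)) hyp₀) (weaken (∷⁺ʳ _ there) d′))

  ∧-right : (a ∧' b) ∈ Δ → Γ ⊢ ⋁ (a ∷ Δ) → Γ ⊢ ⋁ (b ∷ Δ) → Γ ⊢ ⋁ Δ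
  ∧-right i d d′ = ∨-absorb d (∨-absorb (weaken there d′) (⋁-intro i (∧I hyp₁ hyp₀)))

  ∨-right : (a ∨' b) ∈ Δ → Γ ⊢ ⋁ (a ∷ b ∷ Δ) → Γ ⊢ ⋁ Δ
  ∨-right i d = ∨-absorb (∨-absorb d (∨I₂ (⋁-intro i (∨I₁ hyp₀)))) (⋁-intro i (∨I₂ hyp₀))

  ⇒-right-saturate : (a ⇒ b) ∈ Δ → Γ ⊢ ⋁ (b ∷ Δ) → Γ ⊢ ⋁ Δ
  ⇒-right-saturate i d = ∨-absorb d (⋁-intro i (⇒I hyp₁))

  ⇒-right : (a ⇒ b) ∈ Δ → (a ∷ Γ) ⊢ ⋁ (b ∷ []) → Γ ⊢ ⋁ Δ
  ⇒-right i d = ⋁-intro i (⇒I (∨E d hyp₀ (⊥E hyp₀)))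

-- Proof search

Countermodel : List (Formula n) → List (Formula n) → Set
Countermodel Γ Δ = ∃[ α ] IsNode α × All (α ⊩_) Γ × All (λ C → ¬ α ⊩ C) Δ

Decided : List (Formula n) → List (Formula n) → Set
Decided Γ Δ = Γ ⊢ ⋁ Δ ⊎ Countermodel Γ Δ

module _ {n : ℕ} where

  private
    variable
      a b C : Formula n
      Γ Γ′ Δ Δ′ X : List (Formula n)

  countermodel-anti-mono : Γ ⊆ᴸ Γ′ → Δ ⊆ᴸ Δ′ → Countermodel Γ′ Δ′ → Countermodel Γ Δ
  countermodel-anti-mono Γ⊆ Δ⊆ (α , valid , Γ′-forced , Δ′-unforced) =
    α , valid , anti-mono Γ⊆ Γ′-forced , anti-mono Δ⊆ Δ′-unforced

  LeftSaturated : List (Formula n) → List (Formula n) → Formula n → Set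
  LeftSaturated Γ Δ (a ∧' b) = a ∈ Γ × b ∈ Γ
  LeftSaturated Γ Δ (a ∨' b) = a ∈ Γ ⊎ b ∈ Γ
  LeftSaturated Γ Δ (a ⇒ b)  = b ∈ Γ ⊎ a ∈ Δ
  LeftSaturated Γ Δ _        = Unit

  RightSaturated : List (Formula n) → List (Formula n) → Formula n → Set
  RightSaturated Γ Δ (a ∧' b) = a ∈ Δ ⊎ b ∈ Δ
  RightSaturated Γ Δ (a ∨' b) = a ∈ Δ × b ∈ Δ
  RightSaturated Γ Δ (a ⇒ b)  = a ∈ Γ → b ∈ Δ
  RightSaturated Γ Δ _        = Unit

  left-saturated? : ∀ Γ Δ C → Dec (LeftSaturated Γ Δ C)
  left-saturated? Γ Δ (a ∧' b) = a ∈ᶠ? Γ ×-dec b ∈ᶠ? Γ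
  left-saturated? Γ Δ (a ∨' b) = a ∈ᶠ? Γ ⊎-dec b ∈ᶠ? Γ
  left-saturated? Γ Δ (a ⇒ b)  = b ∈ᶠ? Γ ⊎-dec a ∈ᶠ? Δ
  left-saturated? Γ Δ (var _)  = yes tt
  left-saturated? Γ Δ ⊥'       = yes tt
  left-saturated? Γ Δ ⊤'       = yes tt

  right-saturated? : ∀ Γ Δ C → Dec (RightSaturated Γ Δ C)
  right-saturated? Γ Δ (a ∧' b) = a ∈ᶠ? Δ ⊎-dec b ∈ᶠ? Δ
  right-saturated? Γ Δ (a ∨' b) = a ∈ᶠ? Δ ×-dec b ∈ᶠ? Δ
  right-saturated? Γ Δ (a ⇒ b)  = a ∈ᶠ? Γ →-dec b ∈ᶠ? Δ
  right-saturated? Γ Δ (var _)  = yes tt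
  right-saturated? Γ Δ ⊥'       = yes tt
  right-saturated? Γ Δ ⊤'       = yes tt

  record Successors (Γ X : List (Formula n)) : Set where
    field
      nodes  : List (Node n)
      valid  : All (λ β → IsNode β × All (β ⊩_) Γ) nodes
      refute : (a ⇒ b) ∈ X → a ∉ Γ → Any (λ β → β ⊩ a × ¬ β ⊩ b) nodes

  no-successors : Successors Γ []
  no-successors = record { nodes = [] ; valid = [] ; refute = λ () }

  skip : (∀ {a b} → (a ⇒ b) ≡ C → a ∉ Γ → Empty) → Successors Γ X → Successors Γ (C ∷ X)
  skip unrefutable succ = record
    { nodes  = nodes
    ; valid  = valid
    ; refute = λ { (here eq) a∉Γ → ⊥-elim (unrefutable eq a∉Γ) ; (there i) → refute i } }
    where open Successors succ

  add-refuter : IsNode β → All (β ⊩_) Γ → β ⊩ a → ¬ β ⊩ b → Successors Γ X → Successors Γ ((a ⇒ b) ∷ X)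
  add-refuter valid-β Γ-forced a-forced b-unforced succ = record
    { nodes  = _ ∷ nodes
    ; valid  = (valid-β , Γ-forced) ∷ valid
    ; refute = λ { (here refl) _ → here (a-forced , b-unforced) ; (there i) a∉Γ → there (refute i a∉Γ) } }
    where open Successors succ

  vars : List (Formula n) → Subset n
  vars Γ = tabulate λ i → isYes (var i ∈ᶠ? Γ)

  var∈⇒∈vars : ∀ {i} → var i ∈ Γ → i ∈ₛ vars Γ
  var∈⇒∈vars {Γ = Γ} {i} v = lookup⇒[]= i (vars Γ) (trans (lookup∘tabulate _ i) (to T-≡ (fromWitness v)))

  ∈vars⇒var∈ : ∀ {i} → i ∈ₛ vars Γ → var i ∈ Γ
  ∈vars⇒var∈ {Γ = Γ} {i} i∈ =
    toWitness (from T-≡ (trans (sym (lookup∘tabulate _ i)) ([]=⇒lookup i∈)))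

  saturated-countermodel : ⊥' ∉ Γ → ⊤' ∉ Δ → ¬ Any (_∈ Δ) Γ
                         → All (LeftSaturated Γ Δ) Γ → All (RightSaturated Γ Δ) Δ
                         → Successors Γ Δ → Countermodel Γ Δ
  saturated-countermodel {Γ = Γ} {Δ = Δ} ⊥∉Γ ⊤∉Δ disjoint left-sat right-sat succ =
    proj₁ glued , Glues.valid g , All.tabulate (λ {C} C∈Γ → from (glued-⊩⇔ g C) (Γ-true C C∈Γ))
                                , All.tabulate (λ {C} C∈Δ → Δ-false C C∈Δ ∘ to (glued-⊩⇔ g C))
    where
    open Successors succ
    glued : ∃ (Glues nodes (vars Γ))
    glued = glue (All.map proj₁ valid)
                 (All.map (λ (_ , Γ-forced) {_} → All.lookup Γ-forced ∘ ∈vars⇒var∈) valid)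
    g = proj₂ glued
    Γ-true  : ∀ C → C ∈ Γ → ⟨ nodes , vars Γ ⟩⊩ C
    Δ-false : ∀ C → C ∈ Δ → ¬ ⟨ nodes , vars Γ ⟩⊩ C
    Γ-true (var i)  C∈Γ = var∈⇒∈vars C∈Γ
    Γ-true ⊥'       C∈Γ = ⊥∉Γ C∈Γ
    Γ-true ⊤'       C∈Γ = tt
    Γ-true (a ∧' b) C∈Γ = Product.map (Γ-true a) (Γ-true b) (All.lookup left-sat C∈Γ)
    Γ-true (a ∨' b) C∈Γ = Sum.map (Γ-true a) (Γ-true b) (All.lookup left-sat C∈Γ)
    Γ-true (a ⇒ b)  C∈Γ =
      All.map (λ (_ , Γ-forced) → All.lookup Γ-forced C∈Γ) valid ,
      λ a-forced → [ Γ-true b , (λ a∈Δ → ⊥-elim (Δ-false a a∈Δ a-forced)) ]′ (All.lookup left-sat C∈Γ)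
    Δ-false (var i)  C∈Δ i∈U     = disjoint (lose (∈vars⇒var∈ i∈U) C∈Δ)
    Δ-false ⊥'       C∈Δ ()
    Δ-false ⊤'       C∈Δ _       = ⊤∉Δ C∈Δ
    Δ-false (a ∧' b) C∈Δ (a-forced , b-forced) =
      [ (λ a∈Δ → Δ-false a a∈Δ a-forced) , (λ b∈Δ → Δ-false b b∈Δ b-forced) ]′ (All.lookup right-sat C∈Δ)
    Δ-false (a ∨' b) C∈Δ forced with All.lookup right-sat C∈Δ
    ... | a∈Δ , b∈Δ = [ Δ-false a a∈Δ , Δ-false b b∈Δ ]′ forced
    Δ-false (a ⇒ b)  C∈Δ (L-forced , imp) with a ∈ᶠ? Γ
    ... | yes a∈Γ = Δ-false b (All.lookup right-sat C∈Δ a∈Γ) (imp (Γ-true a a∈Γ))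
    ... | no  a∉Γ = lookup-any (All.zip (L-forced , valid)) (refute C∈Δ a∉Γ)
                      λ {β} (f , valid-β , _) (β⊩a , β⊮b) → β⊮b (f β valid-β (≤K-refl β) β⊩a)

module _ {n : ℕ} where

  private
    variable
      a b C : Formula n
      Γ Γ′ Γ₁ Γ₂ Δ Δ′ Δ₁ Δ₂ S : List (Formula n)

  missing : List (Formula n) → List (Formula n) → ℕ
  missing []      Γ = 0
  missing (C ∷ S) Γ with C ∈ᶠ? Γ
  ... | yes _ = missing S Γ
  ... | no  _ = suc (missing S Γ)

  missing-anti-mono : Γ ⊆ᴸ Γ′ → ∀ S → missing S Γ′ ≤ missing S Γ
  missing-anti-mono Γ⊆ [] = z≤n
  missing-anti-mono {Γ} {Γ′} Γ⊆ (C ∷ S) with C ∈ᶠ? Γ | C ∈ᶠ? Γ′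
  ... | yes C∈Γ | no C∉Γ′ = ⊥-elim (C∉Γ′ (Γ⊆ C∈Γ))
  ... | yes _   | yes _   = missing-anti-mono Γ⊆ S
  ... | no _    | yes _   = m≤n⇒m≤1+n (missing-anti-mono Γ⊆ S)
  ... | no _    | no _    = s≤s (missing-anti-mono Γ⊆ S)

  missing-< : Γ ⊆ᴸ Γ′ → C ∈ Γ′ → C ∉ Γ → C ∈ S → missing S Γ′ < missing S Γ
  missing-< {Γ} {Γ′} {S = C′ ∷ S} Γ⊆ C∈Γ′ C∉Γ C∈S with C′ ∈ᶠ? Γ | C′ ∈ᶠ? Γ′ | C∈S
  ... | yes C′∈Γ | no C′∉Γ′ | _         = ⊥-elim (C′∉Γ′ (Γ⊆ C′∈Γ))
  ... | yes C∈Γ  | _        | here refl = ⊥-elim (C∉Γ C∈Γ)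
  ... | no _     | no C∉Γ′  | here refl = ⊥-elim (C∉Γ′ C∈Γ′)
  ... | no _     | yes _    | here refl = s≤s (missing-anti-mono Γ⊆ S)
  ... | yes _    | yes _    | there C∈S′ = missing-< Γ⊆ C∈Γ′ C∉Γ C∈S′
  ... | no _     | yes _    | there C∈S′ = m<n⇒m<1+n (missing-< Γ⊆ C∈Γ′ C∉Γ C∈S′)
  ... | no _     | no _     | there C∈S′ = s≤s (missing-< Γ⊆ C∈Γ′ C∉Γ C∈S′)

  missing-<¹ : a ∈ S → a ∉ Γ → missing S (a ∷ Γ) < missing S Γ
  missing-<¹ a∈S a∉Γ = missing-< there (here refl) a∉Γ a∈S

  missing-<² : a ∈ S → b ∈ S → ¬ (a ∈ Γ × b ∈ Γ) → missing S (a ∷ b ∷ Γ) < missing S Γ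
  missing-<² {a = a} {Γ = Γ} a∈S b∈S unsat with a ∈ᶠ? Γ
  ... | no  a∉Γ = missing-< (there ∘ there) (here refl) a∉Γ a∈S
  ... | yes a∈Γ = missing-< (there ∘ there) (there (here refl)) (λ b∈Γ → unsat (a∈Γ , b∈Γ)) b∈S

  by-rule : (Γ′ ⊢ ⋁ Δ′ → Γ ⊢ ⋁ Δ) → Γ ⊆ᴸ Γ′ → Δ ⊆ᴸ Δ′ → Decided Γ′ Δ′ → Decided Γ Δ
  by-rule rule Γ⊆ Δ⊆ = Sum.map rule (countermodel-anti-mono Γ⊆ Δ⊆)

  by-rule₂ : (Γ₁ ⊢ ⋁ Δ₁ → Γ₂ ⊢ ⋁ Δ₂ → Γ ⊢ ⋁ Δ) → Γ ⊆ᴸ Γ₁ → Δ ⊆ᴸ Δ₁ → Γ ⊆ᴸ Γ₂ → Δ ⊆ᴸ Δ₂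
           → Decided Γ₁ Δ₁ → Decided Γ₂ Δ₂ → Decided Γ Δ
  by-rule₂ rule Γ⊆₁ Δ⊆₁ Γ⊆₂ Δ⊆₂ d₁ d₂ =
    [ (λ p₁ → by-rule (rule p₁) Γ⊆₂ Δ⊆₂ d₂) , inj₂ ∘ countermodel-anti-mono Γ⊆₁ Δ⊆₁ ]′ d₁

module Search {n : ℕ} (S : List (Formula n)) (S-closed : SubformulaClosed S) where

  Sequent : Set
  Sequent = List (Formula n) × List (Formula n)

  -- Lexicographic, because refuting a ⇒ b ∈ Δ searches a ∷ Γ ⇒ b, which may enlarge the Δ-count.
  _⊏_ : Rel Sequent 0ℓ
  _⊏_ = ×-Lex _≡_ _<_ _<_ on Product.map (missing S) (missing S)

  ⊏-wellFounded : WellFounded _⊏_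
  ⊏-wellFounded = On.wellFounded _ (×-wellFounded <-wellFounded <-wellFounded)

  Goal : Sequent → Set
  Goal (Γ , Δ) = Γ ⊆ᴸ S → Δ ⊆ᴸ S → Decided Γ Δ

  module Step {Γ Δ : List (Formula n)} (Γ⊆S : Γ ⊆ᴸ S) (Δ⊆S : Δ ⊆ᴸ S)
              (search′ : WfRec _⊏_ Goal (Γ , Δ)) where

    private
      variable
        a b ψ : Formula n
        X : List (Formula n)

    ∈S-left : a ∈ Γ → ψ ∈Sub a → ψ ∈ S
    ∈S-left = S-closed ∘ Γ⊆S

    ∈S-right : a ∈ Δ → ψ ∈Sub a → ψ ∈ S
    ∈S-right = S-closed ∘ Δ⊆S

    add-left : a ∈ S → a ∉ Γ → Decided (a ∷ Γ) Δ
    add-left {a} a∈S a∉Γ = search′ {a ∷ Γ , Δ} (inj₁ (missing-<¹ a∈S a∉Γ)) (∈-∷⁺ʳ a∈S Γ⊆S) Δ⊆S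

    add-left² : a ∈ S → b ∈ S → ¬ (a ∈ Γ × b ∈ Γ) → Decided (a ∷ b ∷ Γ) Δ
    add-left² {a} {b} a∈S b∈S unsat =
      search′ {a ∷ b ∷ Γ , Δ} (inj₁ (missing-<² a∈S b∈S unsat)) (∈-∷⁺ʳ a∈S (∈-∷⁺ʳ b∈S Γ⊆S)) Δ⊆S

    add-right : a ∈ S → a ∉ Δ → Decided Γ (a ∷ Δ)
    add-right {a} a∈S a∉Δ = search′ {Γ , a ∷ Δ} (inj₂ (refl , missing-<¹ a∈S a∉Δ)) Γ⊆S (∈-∷⁺ʳ a∈S Δ⊆S)

    add-right² : a ∈ S → b ∈ S → ¬ (a ∈ Δ × b ∈ Δ) → Decided Γ (a ∷ b ∷ Δ)
    add-right² {a} {b} a∈S b∈S unsat =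
      search′ {Γ , a ∷ b ∷ Δ} (inj₂ (refl , missing-<² a∈S b∈S unsat)) Γ⊆S (∈-∷⁺ʳ a∈S (∈-∷⁺ʳ b∈S Δ⊆S))

    left-rule : ∀ C → C ∈ Γ → ¬ LeftSaturated Γ Δ C → Decided Γ Δ
    left-rule (a ∧' b) i unsat =
      by-rule (∧-left i) (there ∘ there) id (add-left² (∈S-left i (∧l here)) (∈S-left i (∧r here)) unsat)
    left-rule (a ∨' b) i unsat =
      by-rule₂ (∨-left i) there id there id
        (add-left (∈S-left i (∨l here)) (unsat ∘ inj₁)) (add-left (∈S-left i (∨r here)) (unsat ∘ inj₂))
    left-rule (a ⇒ b)  i unsat =
      by-rule₂ (⇒-left i) id there there id
        (add-right (∈S-left i (⇒l here)) (unsat ∘ inj₂)) (add-left (∈S-left i (⇒r here)) (unsat ∘ inj₁))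
    left-rule (var _)  _ unsat = ⊥-elim (unsat tt)
    left-rule ⊥'       _ unsat = ⊥-elim (unsat tt)
    left-rule ⊤'       _ unsat = ⊥-elim (unsat tt)

    right-rule : ∀ C → C ∈ Δ → ¬ RightSaturated Γ Δ C → Decided Γ Δ
    right-rule (a ∧' b) i unsat =
      by-rule₂ (∧-right i) id there id there
        (add-right (∈S-right i (∧l here)) (unsat ∘ inj₁)) (add-right (∈S-right i (∧r here)) (unsat ∘ inj₂))
    right-rule (a ∨' b) i unsat =
      by-rule (∨-right i) id (there ∘ there) (add-right² (∈S-right i (∨l here)) (∈S-right i (∨r here)) unsat)
    right-rule (a ⇒ b)  i unsat =
      by-rule (⇒-right-saturate i) id there (add-right (∈S-right i (⇒r here)) (unsat ∘ λ b∈Δ _ → b∈Δ))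
    right-rule (var _)  _ unsat = ⊥-elim (unsat tt)
    right-rule ⊥'       _ unsat = ⊥-elim (unsat tt)
    right-rule ⊤'       _ unsat = ⊥-elim (unsat tt)

    add-successor : ∀ C → C ∈ Δ → Successors Γ X → Γ ⊢ ⋁ Δ ⊎ Successors Γ (C ∷ X)
    add-successor (a ⇒ b) i succ with a ∈ᶠ? Γ
    ... | yes a∈Γ = inj₂ (skip (λ { refl a∉Γ → a∉Γ a∈Γ }) succ)
    ... | no  a∉Γ =
      Sum.map (⇒-right i) (λ { (β , valid , a-forced ∷ Γ-forced , b-unforced ∷ []) →
                                 add-refuter valid Γ-forced a-forced b-unforced succ })
        (search′ {a ∷ Γ , b ∷ []} (inj₁ (missing-<¹ a∈S a∉Γ)) (∈-∷⁺ʳ a∈S Γ⊆S) (∈-∷⁺ʳ b∈S λ ()))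
      where
      a∈S = ∈S-right i (⇒l here)
      b∈S = ∈S-right i (⇒r here)
    add-successor (var _)  _ = inj₂ ∘ skip λ ()
    add-successor ⊥'       _ = inj₂ ∘ skip λ ()
    add-successor ⊤'       _ = inj₂ ∘ skip λ ()
    add-successor (_ ∧' _) _ = inj₂ ∘ skip λ ()
    add-successor (_ ∨' _) _ = inj₂ ∘ skip λ ()

    successors : ∀ X → X ⊆ᴸ Δ → Γ ⊢ ⋁ Δ ⊎ Successors Γ X
    successors []      _    = inj₂ no-successors
    successors (C ∷ X) X⊆Δ = [ inj₁ , add-successor C (X⊆Δ (here refl)) ]′ (successors X (X⊆Δ ∘ there))

    decided : Decided Γ Δ
    decided with ⊥' ∈ᶠ? Γ | ⊤' ∈ᶠ? Δ | any? (_∈ᶠ? Δ) Γ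
    ... | yes ⊥∈Γ | _       | _      = inj₁ (⊥E (hyp ⊥∈Γ))
    ... | no _    | yes ⊤∈Δ | _      = inj₁ (⋁-intro ⊤∈Δ ⊤I)
    ... | no _    | no _    | yes Γ∩Δ with find Γ∩Δ
    ...   | _ , C∈Γ , C∈Δ = inj₁ (⋁-intro C∈Δ (hyp C∈Γ))
    decided | no ⊥∉Γ | no ⊤∉Δ | no disjoint
      with All.all? (left-saturated? Γ Δ) Γ | All.all? (right-saturated? Γ Δ) Δ
    ... | no unsat | _ with find (¬All⇒Any¬ (left-saturated? Γ Δ) Γ unsat)
    ...   | C , C∈Γ , C-unsat = left-rule C C∈Γ C-unsat
    decided | no ⊥∉Γ | no ⊤∉Δ | no disjoint | yes _ | no unsat
      with find (¬All⇒Any¬ (right-saturated? Γ Δ) Δ unsat)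
    ...   | C , C∈Δ , C-unsat = right-rule C C∈Δ C-unsat
    decided | no ⊥∉Γ | no ⊤∉Δ | no disjoint | yes left-sat | yes right-sat =
      Sum.map₂ (saturated-countermodel ⊥∉Γ ⊤∉Δ disjoint left-sat right-sat) (successors Δ id)

  search : ∀ Γ Δ → Γ ⊆ᴸ S → Δ ⊆ᴸ S → Decided Γ Δ
  search Γ Δ =
    WF.All.wfRec ⊏-wellFounded _ Goal (λ _ search′ Γ⊆S Δ⊆S → Step.decided Γ⊆S Δ⊆S search′) (Γ , Δ)

completeness : (θ ψ : Formula n) → (θ ∷ []) ⊢ ψ ⊎ ∃[ α ] IsNode α × α ⊩ θ × ¬ α ⊩ ψ
completeness θ ψ
  with Search.search S (subformulas-closed (θ ⇒ ψ)) (θ ∷ []) (ψ ∷ []) (single (⇒l here)) (single (⇒r here))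
  where
  S = subformulas (θ ⇒ ψ)
  single : ∀ {χ} → χ ∈Sub (θ ⇒ ψ) → (χ ∷ []) ⊆ᴸ S
  single χ≤ (here refl) = ∈Sub⇒∈subformulas _ χ≤
... | inj₁ d = inj₁ (∨E d hyp₀ (⊥E hyp₀))
... | inj₂ (α , valid , θ-forced ∷ [] , ψ-unforced ∷ []) = inj₂ (α , valid , θ-forced , ψ-unforced)

provable? : (θ ψ : Formula n) → Dec ((θ ∷ []) ⊢ ψ)
provable? θ ψ =
  [ yes
  , (λ (α , valid , θ-forced , ψ-unforced) → no λ θ⊢ψ → ψ-unforced (soundness θ⊢ψ valid (θ-forced ∷ [])))
  ]′ (completeness θ ψ)

-- Join-irreducibility and the minimum of C(φ)

module _ {n : ℕ} {φ : Formula n} where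

  -- φ ⊢ ψ ∨ ⋁ Ψ makes φ equivalent to (φ ∧ ψ) ∨ (φ ∧ ⋁ Ψ).
  ⊬⋁-of-join-irreducible : JoinIrreducible φ → {Ψ : List (Formula n)}
                         → All (λ ψ → ¬ (φ ∷ []) ⊢ ψ) Ψ → ¬ (φ ∷ []) ⊢ ⋁ Ψ
  ⊬⋁-of-join-irreducible (not-⊥ , _) [] d = not-⊥ (d , ⊥E hyp₀)
  ⊬⋁-of-join-irreducible ji@(_ , split) {ψ ∷ Ψ} (φ⊬ψ ∷ φ⊬Ψ) d
    with split (φ ∧' ψ) (φ ∧' ⋁ Ψ)
               (∨E d (∨I₁ (∧I hyp₁ hyp₀)) (∨I₂ (∧I hyp₁ hyp₀)) , ∨E hyp₀ (∧E₁ hyp₀) (∧E₁ hyp₀))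
  ... | inj₁ (φ⊢φ∧ψ , _) = φ⊬ψ (∧E₂ φ⊢φ∧ψ)
  ... | inj₂ (φ⊢φ∧⋁Ψ , _) = ⊬⋁-of-join-irreducible ji φ⊬Ψ (∧E₂ φ⊢φ∧⋁Ψ)

  join-irreducible⇒minimum : JoinIrreducible φ → CHasMinimum φ
  join-irreducible⇒minimum ji =
    [ ⊥-elim ∘ ⊬⋁-of-join-irreducible ji (all-filter unprovable? (subformulas φ)) , minimum ]′
    (completeness φ (⋁ unprovable))
    where
    unprovable? = ¬? ∘ provable? φ
    unprovable = filter unprovable? (subformulas φ)
    minimum : (∃[ α ] IsNode α × α ⊩ φ × ¬ α ⊩ ⋁ unprovable) → CHasMinimum φ
    minimum (α , valid , φ-forced , ⋁-unforced) = α , valid , φ-forced , below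
      where
      below : ∀ β → IsNode β → β ⊩ φ → TypeSubset φ α β
      below β valid-β φ-forced-β ψ ψ≤φ ψ-forced with provable? φ ψ
      ... | yes φ⊢ψ = soundness φ⊢ψ valid-β (φ-forced-β ∷ [])
      ... | no  φ⊬ψ = ⊥-elim (⋁-unforced (⋁-forced (∈-filter⁺ _ (∈Sub⇒∈subformulas φ ψ≤φ) φ⊬ψ) ψ-forced))

  module _ (valid : IsNode α) (α∈L : α ∈ L) (α-least : All (TypeSubset φ α) L) where

    minimum-⊩⇔-glued : ∀ χ → χ ∈Sub φ → α ⊩ χ ⇔ ⟨ L , ⋂ (map w L) ⟩⊩ χ
    minimum-⊩⇔-glued (var i) χ≤φ =
      mk⇔ (λ i∈α → ∈-⋂ (All.map⁺ (All.map (λ α⊑β → α⊑β (var i) χ≤φ i∈α) α-least)))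
          (All.lookup (All.map⁻ (⋂-lower-bound (map w L))) α∈L)
    minimum-⊩⇔-glued ⊥'       _   = ⇔.refl
    minimum-⊩⇔-glued ⊤'       _   = ⇔.refl
    minimum-⊩⇔-glued (a ∧' b) χ≤φ =
      minimum-⊩⇔-glued a (∈Sub-trans (∧l here) χ≤φ) ×-⇔ minimum-⊩⇔-glued b (∈Sub-trans (∧r here) χ≤φ)
    minimum-⊩⇔-glued (a ∨' b) χ≤φ =
      minimum-⊩⇔-glued a (∈Sub-trans (∨l here) χ≤φ) ⊎-⇔ minimum-⊩⇔-glued b (∈Sub-trans (∨r here) χ≤φ)
    minimum-⊩⇔-glued (a ⇒ b)  χ≤φ = mk⇔
      (λ f → All.map (λ α⊑β → α⊑β (a ⇒ b) χ≤φ f) α-least ,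
             λ a-glued → to b⇔ (f α valid (≤K-refl α) (from a⇔ a-glued)))
      (λ (L-forced , _) → All.lookup L-forced α∈L)
      where
      a⇔ = minimum-⊩⇔-glued a (∈Sub-trans (⇒l here) χ≤φ)
      b⇔ = minimum-⊩⇔-glued b (∈Sub-trans (⇒r here) χ≤φ)

  minimum⇒common-lower-bound : CHasMinimum φ → All (λ β → IsNode β × β ⊩ φ) L
                             → ∃[ δ ] IsNode δ × δ ⊩ φ × All (δ ≤K_) L
  minimum⇒common-lower-bound {L = L} (α , valid , φ-forced , minimum) L-forcing
    with glue (valid ∷ All.map proj₁ L-forcing) (All.map⁻ (⋂-lower-bound (map w (α ∷ L))))
  ... | δ , g =
    δ , Glues.valid g ,
    from (glued-⊩⇔ g φ) (to (minimum-⊩⇔-glued valid (here refl) α-least φ here) φ-forced) ,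
    All.tail (Glues.below g)
    where
    α-least = (λ _ _ → id) ∷ All.map (λ (valid-β , φ-forced-β) → minimum _ valid-β φ-forced-β) L-forcing

  minimum⇒join-irreducible : CHasMinimum φ → JoinIrreducible φ
  minimum⇒join-irreducible min@(α , valid , φ-forced , _) = φ≢⊥ , split
    where
    φ≢⊥ : ¬ φ ≡H ⊥'
    φ≢⊥ (φ⊢⊥ , _) = soundness φ⊢⊥ valid (φ-forced ∷ [])
    split : ∀ ψ χ → φ ≡H (ψ ∨' χ) → φ ≡H ψ ⊎ φ ≡H χ
    split ψ χ (φ⊢ψ∨χ , ψ∨χ⊢φ) with completeness φ ψ | completeness φ χ
    ... | inj₁ φ⊢ψ | _ = inj₁ (φ⊢ψ , cut (∨I₁ hyp₀) (weaken (∷⁺ʳ _ λ ()) ψ∨χ⊢φ))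
    ... | inj₂ _   | inj₁ φ⊢χ = inj₂ (φ⊢χ , cut (∨I₂ hyp₀) (weaken (∷⁺ʳ _ λ ()) ψ∨χ⊢φ))
    ... | inj₂ (β , valid-β , φ-β , ψ-β) | inj₂ (γ , valid-γ , φ-γ , χ-γ)
      with minimum⇒common-lower-bound min ((valid-β , φ-β) ∷ (valid-γ , φ-γ) ∷ [])
    ...   | δ , valid-δ , φ-δ , δ≤β ∷ δ≤γ ∷ [] =
      ⊥-elim ([ ψ-β ∘ ⊩-mono valid-δ δ≤β ψ , χ-γ ∘ ⊩-mono valid-δ δ≤γ χ ]′
                (soundness φ⊢ψ∨χ valid-δ (φ-δ ∷ [])))

mainTheorem2 : (n : ℕ) → 1 ≤ n → (φ : Formula n) →
    JoinIrreducible φ ⇔ CHasMinimum φ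
mainTheorem2 n _ φ = mk⇔ join-irreducible⇒minimum minimum⇒join-irreducible
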